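{- Let $G=(V,E)$ be a finite simple graph and $w\in V^*$ a word. Then $F_G^w(x)$ is (the characteristic vector of) an independent set of $G$ for every $x\in\{0,1\}^V$ if and only if the set $[w]$ of vertices occurring in $w$ is a vertex cover of $G$.
   Context: The MIS network of $G$ is the map $F_G:\{0,1\}^V\to\{0,1\}^V$ given by $F_G(x)_v=\bigwedge_{u\in N(v)}\neg x_u$ (with $F_G(x)_v=1$ if $v$ has no neighbours), where $N(v)$ is the set of neighbours of $v$. For $v\in V$, $F_G^v$ is the map with $F_G^v(x)_v=F_G(x)_v$ and $F_G^v(x)_u=x_u$ for $u\neq v$. For a word $w=w_1\dots w_l\in V^*$, $F_G^w=F_G^{w_l}\circ\dots\circ F_G^{w_1}$. A configuration $x$ is identified with its support $\{v: x_v=1\}$. -}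

module Defs where

open import Data.Nat using (ℕ)
open import Data.Fin using (Fin; _≟_)
open import Data.Bool using (Bool; true; false; not; _∧_; if_then_else_)
open import Data.List using (List; []; _∷_; allFin; map)
open import Data.Bool.ListAction using (and)
open import Data.List.Membership.Propositional using (_∈_)
open import Relation.Binary.PropositionalEquality using (_≡_)
open import Relation.Nullary using (¬_; does)
open import Data.Sum using (_⊎_)
open import Data.Product using (_×_)

record Graph (n : ℕ) : Set where
  field
    adj     : Fin n → Fin n → Bool
    symm    : ∀ u v → adj u v ≡ adj v u
    irrefl  : ∀ v → adj v v ≡ false

open Graph public

Config : ℕ → Set
Config n = Fin n → Bool

F : ∀ {n} → Graph n → Config n → Config n
F G x v = and (map (λ u → not (adj G v u ∧ x u)) (allFin _))

Fᵥ : ∀ {n} → Graph n → Fin n → Config n → Config n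
Fᵥ G v x u = if does (u ≟ v) then F G x v else x u

-- F_G^w = F^{w_l} ∘ … ∘ F^{w_1}  (w_1 applied first).
Fʷ : ∀ {n} → Graph n → List (Fin n) → Config n → Config n
Fʷ G []      x = x
Fʷ G (v ∷ w) x = Fʷ G w (Fᵥ G v x)

Independent : ∀ {n} → Graph n → Config n → Set
Independent G x = ∀ u v → adj G u v ≡ true → ¬ (x u ≡ true × x v ≡ true)

VertexCover : ∀ {n} → Graph n → List (Fin n) → Set
VertexCover G S = ∀ u v → adj G u v ≡ true → (u ∈ S) ⊎ (v ∈ S)

{-# OPTIONS --safe #-}
module Submission where

open import Defs
open import Data.Fin using (Fin; _≟_)
open import Data.List using (List; []; _∷_)
open import Data.Bool using (true; T; not; _∧_)
open import Data.Bool.Properties using (T-≡)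
open import Data.List.Membership.Propositional using (_∈_; _∉_)
open import Data.List.Membership.Propositional.Properties using (∈-allFin)
open import Data.List.Membership.DecPropositional using (_∈?_)
open import Data.List.Relation.Unary.All using (lookup)
open import Data.List.Relation.Unary.All.Properties using (all⁺)
open import Data.List.Relation.Unary.Any using (here; there)
open import Data.Sum using (inj₁; inj₂)
open import Data.Product using (_×_; _,_)
open import Data.Empty using (⊥-elim)
open import Function using (_∘_)
open import Function.Bundles using (_⇔_; mk⇔; Equivalence)
open import Relation.Nullary using (¬_; Dec; yes; no)
open import Relation.Binary.PropositionalEquality using (_≡_; _≢_; refl; sym; trans; subst; cong₂)

-- Updating a vertex a makes every edge at a independent, since a is switched on
-- only when all its neighbours are off, and it keeps every other edge as it was.
-- So after F^w every edge with an endpoint in w is independent. Conversely, an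
-- edge with no endpoint in w is never updated: from the all-ones configuration
-- both of its ends stay on.

NotBothOn : ∀ {n} → Config n → Fin n → Fin n → Set
NotBothOn x u v = ¬ (x u ≡ true × x v ≡ true)

NotBothOn-sym : ∀ {n} (x : Config n) u v → NotBothOn x u v → NotBothOn x v u
NotBothOn-sym x u v notBoth (xv , xu) = notBoth (xu , xv)

module _ {n} (G : Graph n) where

  adj-sym : ∀ {u v} → adj G u v ≡ true → adj G v u ≡ true
  adj-sym {u} {v} uv = trans (symm G v u) uv

  adj⇒≢ : ∀ {u v} → adj G u v ≡ true → u ≢ v
  adj⇒≢ {u} uv refl with trans (sym uv) (irrefl G u)
  ... | ()

  F-on⇒neighbour-off : ∀ x {a v} → F G x a ≡ true → adj G a v ≡ true → x v ≢ true
  F-on⇒neighbour-off x {a} {v} Fa av xv =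
    subst (T ∘ not) (cong₂ _∧_ av xv) neighbour-term
    where
    neighbour-term : T (not (adj G a v ∧ x v))
    neighbour-term = lookup (all⁺ _ _ (Equivalence.from T-≡ Fa)) (∈-allFin v)

  Fᵥ-self : ∀ x a → Fᵥ G a x a ≡ F G x a
  Fᵥ-self x a with a ≟ a
  ... | yes _  = refl
  ... | no a≢a with () ← a≢a refl

  Fᵥ-other : ∀ x {a u} → u ≢ a → Fᵥ G a x u ≡ x u
  Fᵥ-other x {a} {u} u≢a with u ≟ a
  ... | yes u≡a with () ← u≢a u≡a
  ... | no _    = refl

  Fᵥ-settles-edge : ∀ x {a v} → adj G a v ≡ true → NotBothOn (Fᵥ G a x) a v
  Fᵥ-settles-edge x {a} av (Fᵥa , Fᵥv) =
    F-on⇒neighbour-off x (trans (sym (Fᵥ-self x a)) Fᵥa) av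
      (trans (sym (Fᵥ-other x (adj⇒≢ av ∘ sym))) Fᵥv)

  Fᵥ-preserves-edge : ∀ x a {u v} → adj G u v ≡ true →
                      NotBothOn x u v → NotBothOn (Fᵥ G a x) u v
  Fᵥ-preserves-edge x a {u} {v} uv notBoth = by-cases (u ≟ a) (v ≟ a)
    where
    by-cases : Dec (u ≡ a) → Dec (v ≡ a) → NotBothOn (Fᵥ G a x) u v
    by-cases (yes refl) _          = Fᵥ-settles-edge x uv
    by-cases (no _)     (yes refl) = NotBothOn-sym (Fᵥ G a x) a u (Fᵥ-settles-edge x (adj-sym uv))
    by-cases (no u≢a)   (no v≢a)   (Fᵥu , Fᵥv) =
      notBoth (trans (sym (Fᵥ-other x u≢a)) Fᵥu , trans (sym (Fᵥ-other x v≢a)) Fᵥv)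

  Fʷ-preserves-edge : ∀ w x {u v} → adj G u v ≡ true →
                      NotBothOn x u v → NotBothOn (Fʷ G w x) u v
  Fʷ-preserves-edge []      x uv notBoth = notBoth
  Fʷ-preserves-edge (a ∷ w) x uv notBoth =
    Fʷ-preserves-edge w (Fᵥ G a x) uv (Fᵥ-preserves-edge x a uv notBoth)

  Fʷ-settles-edge : ∀ w x {u v} → adj G u v ≡ true → u ∈ w → NotBothOn (Fʷ G w x) u v
  Fʷ-settles-edge (a ∷ w) x uv (here refl) =
    Fʷ-preserves-edge w (Fᵥ G a x) uv (Fᵥ-settles-edge x uv)
  Fʷ-settles-edge (a ∷ w) x uv (there u∈w) = Fʷ-settles-edge w (Fᵥ G a x) uv u∈w

  Fʷ-outside : ∀ w x {u} → u ∉ w → Fʷ G w x u ≡ x u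
  Fʷ-outside []      x u∉w = refl
  Fʷ-outside (a ∷ w) x u∉w =
    trans (Fʷ-outside w (Fᵥ G a x) (u∉w ∘ there)) (Fᵥ-other x (u∉w ∘ here))

proposition5p3 : ∀ {n} (G : Graph n) (w : List (Fin n)) →
    (∀ (x : Config n) → Independent G (Fʷ G w x)) ⇔ VertexCover G w
proposition5p3 {n} G w = mk⇔ independent⇒cover cover⇒independent
  where
  cover⇒independent : VertexCover G w → ∀ x → Independent G (Fʷ G w x)
  cover⇒independent cover x u v uv with cover u v uv
  ... | inj₁ u∈w = Fʷ-settles-edge G w x uv u∈w
  ... | inj₂ v∈w = NotBothOn-sym (Fʷ G w x) v u (Fʷ-settles-edge G w x (adj-sym G uv) v∈w)

  independent⇒cover : (∀ x → Independent G (Fʷ G w x)) → VertexCover G w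
  independent⇒cover independent u v uv with _∈?_ _≟_ u w | _∈?_ _≟_ v w
  ... | yes u∈w | _       = inj₁ u∈w
  ... | no _    | yes v∈w = inj₂ v∈w
  ... | no u∉w  | no v∉w  =
    ⊥-elim (independent allOn u v uv (Fʷ-outside G w allOn u∉w , Fʷ-outside G w allOn v∉w))
    where
    allOn : Config n
    allOn _ = true
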